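{- Let $n\ge4$. Then $\mathbf K_n^\emptyset$ is the smallest admissible subalgebra of $K(\mathbf{DP}_n)$. Moreover, every sublattice of $K(\mathbf{DP}_n)$ that is closed under $\sim$ and contains $K_n^\emptyset$ is the universe of an admissible subalgebra of $K(\mathbf{DP}_n)$.
   Context: For a bounded commutative residuated lattice $\mathbf A$ (lattice, commutative monoid, $ab\le c$ iff $a\le b\to c$, $1$ greatest, $0$ least), $K(\mathbf A)$ is the algebra on $A\times A$ with $(a,b)\vee(c,d)=(a\vee c,b\wedge d)$, $(a,b)\wedge(c,d)=(a\wedge c,b\vee d)$, $(a,b)(c,d)=(ac,(a\to d)\wedge(c\to b))$, $(a,b)\to(c,d)=((a\to c)\wedge(d\to b),ad)$, unit $(1,1)$, constant $0$ as $(0,1)$; $\sim x:=x\to(1,1)$, so $\sim(a,b)=(b,a)$. A subalgebra $\mathbf S$ of $K(\mathbf A)$ is admissible if the elements of $S$ below $(1,1)$ are exactly all $(a,1)$, $a\in A$. The drastic product chain $\mathbf{DP}_n$ has universe $\{0=a_{n-1}<a_{n-2}<\dots<a_1<1\}$, product $xy=0$ if $x,y\ne1$ and $xy=x\wedge y$ otherwise, implication $x\to y=1$ if $x\le y$, $=a_1$ if $1>x>y$, $1\to y=y$. $K_n^\emptyset=\{(x,1),(1,x),(x,a_1),(a_1,x):x\in DP_n\}$ and $\mathbf K_n^\emptyset$ the corresponding subalgebra. -}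

module Defs where

open import Data.Nat using (ℕ; zero; suc)
open import Data.Fin using (Fin; zero; suc; fromℕ; inject₁; _≤?_; _≟_)
open import Data.Fin.Properties using ()
open import Data.Product using (_×_; _,_; Σ; ∃; ∃-syntax)
open import Data.Sum using (_⊎_)
open import Relation.Nullary using (yes; no)
open import Relation.Binary.PropositionalEquality using (_≡_)
open import Function.Bundles using (_⇔_)
open import Level using (Level; 0ℓ)

-- Carrier: Fin n with the natural order of Fin; zero is the bottom 0 = a_{n-1},
-- the greatest index (fromℕ (suc k)) is the top 1, and its predecessor is a_1.
-- In general, a_i is represented by the index (n - 1 - i).
module DP (k : ℕ) where

  n : ℕ
  n = suc (suc k)

  D : Set
  D = Fin n

  ⊤D : D
  ⊤D = fromℕ (suc k)

  a₁ : D
  a₁ = inject₁ (fromℕ k)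

  ⊥D : D
  ⊥D = zero

  _⊓_ : D → D → D
  x ⊓ y with x ≤? y
  ... | yes _ = x
  ... | no  _ = y

  _⊔_ : D → D → D
  x ⊔ y with x ≤? y
  ... | yes _ = y
  ... | no  _ = x

  _·_ : D → D → D
  x · y with x ≟ ⊤D | y ≟ ⊤D
  ... | yes _ | _     = x ⊓ y
  ... | no _  | yes _ = x ⊓ y
  ... | no _  | no _  = ⊥D

  _⇒_ : D → D → D
  x ⇒ y with x ≤? y
  ... | yes _ = ⊤D
  ... | no _ with x ≟ ⊤D
  ...   | yes _ = y
  ...   | no _  = a₁

  K : Set
  K = D × D

  _∨K_ : K → K → K
  (a , b) ∨K (c , d) = (a ⊔ c , b ⊓ d)

  _∧K_ : K → K → K
  (a , b) ∧K (c , d) = (a ⊓ c , b ⊔ d)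

  _·K_ : K → K → K
  (a , b) ·K (c , d) = (a · c , (a ⇒ d) ⊓ (c ⇒ b))

  _⇒K_ : K → K → K
  (a , b) ⇒K (c , d) = ((a ⇒ c) ⊓ (d ⇒ b) , a · d)

  1K : K
  1K = (⊤D , ⊤D)

  0K : K
  0K = (⊥D , ⊤D)

  ∼_ : K → K
  ∼ x = x ⇒K 1K

  _≤K_ : K → K → Set
  x ≤K y = (x ∧K y) ≡ x

  Subset : Set₁
  Subset = K → Set

  _⊆_ : Subset → Subset → Set
  S ⊆ T = ∀ x → S x → T x

  record IsSublattice (S : Subset) : Set where
    field
      ∨-closed : ∀ x y → S x → S y → S (x ∨K y)
      ∧-closed : ∀ x y → S x → S y → S (x ∧K y)

  record IsSubalgebra (S : Subset) : Set where
    field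
      ∨-closed : ∀ x y → S x → S y → S (x ∨K y)
      ∧-closed : ∀ x y → S x → S y → S (x ∧K y)
      ·-closed : ∀ x y → S x → S y → S (x ·K y)
      ⇒-closed : ∀ x y → S x → S y → S (x ⇒K y)
      1-closed : S 1K
      0-closed : S 0K

  IsAdmissible : Subset → Set
  IsAdmissible S = ∀ x → (S x × x ≤K 1K) ⇔ (∃[ a ] x ≡ (a , ⊤D))

  IsAdmissibleSubalgebra : Subset → Set
  IsAdmissibleSubalgebra S = IsSubalgebra S × IsAdmissible S

  K∅ : Subset
  K∅ p = ∃[ x ] (p ≡ (x , ⊤D) ⊎ p ≡ (⊤D , x) ⊎ p ≡ (x , a₁) ⊎ p ≡ (a₁ , x))

{-# OPTIONS --safe #-}
module Submission where

open import Defs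
open import Data.Nat using (ℕ; suc; _≤_)
import Data.Nat as ℕ
import Data.Nat.Properties as ℕ
open import Data.Fin using (zero; suc; fromℕ; toℕ; _≟_; _≤?_)
import Data.Fin as Fin
import Data.Fin.Properties as Fin
open import Data.Product using (_×_; _,_; proj₁; proj₂; ∃-syntax)
open import Data.Sum using (_⊎_; inj₁; inj₂)
open import Relation.Nullary using (Dec; yes; no; ¬_)
open import Relation.Nullary.Negation using (contradiction)
open import Relation.Binary.PropositionalEquality
open import Function.Bundles using (mk⇔; Equivalence)

-- K∅ consists of the pairs with a coordinate in the top block {a₁, 1}.  In
-- DP_n every x ≠ 1 has x → y ∈ {a₁, 1}, so a product or implication of two
-- pairs either has a coordinate in that block or, when a 1 occurs in the
-- right place, collapses to an argument or the negation of one.  Hence any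
-- ∼-closed sublattice containing K∅ is a subalgebra, and it is admissible
-- because it contains every (x, 1).  Conversely an admissible subalgebra
-- contains every (x, 1) and (1, x); multiplying by (1, 0) yields (x, a₁) for
-- 0 < x < 1, and for n ≥ 4 there is some 0 < y < a₁, whence
-- (a₁, 1)(a₁, y) = (0, a₁).
module DP-Properties (k : ℕ) where
  open DP k

  Upper : D → Set
  Upper z = a₁ Fin.≤ z

  toℕ-a₁ : toℕ a₁ ≡ k
  toℕ-a₁ = trans (Fin.toℕ-inject₁ (fromℕ k)) (Fin.toℕ-fromℕ k)

  toℕ-⊤ : toℕ ⊤D ≡ suc k
  toℕ-⊤ = Fin.toℕ-fromℕ (suc k)

  ≤⊤ : ∀ x → x Fin.≤ ⊤D
  ≤⊤ = Fin.≤fromℕ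

  upper-⊤ : Upper ⊤D
  upper-⊤ = ≤⊤ a₁

  upper-a₁ : Upper a₁
  upper-a₁ = Fin.≤-refl

  a₁≢⊤ : a₁ ≢ ⊤D
  a₁≢⊤ a₁≡⊤ = Fin.fromℕ≢inject₁ (sym a₁≡⊤)

  <a₁⇒≢⊤ : ∀ {y} → y Fin.< a₁ → y ≢ ⊤D
  <a₁⇒≢⊤ y<a₁ refl = ℕ.<⇒≱ y<a₁ (≤⊤ a₁)

  upper⇒a₁⊎⊤ : ∀ z → Upper z → z ≡ a₁ ⊎ z ≡ ⊤D
  upper⇒a₁⊎⊤ z a₁≤z with ℕ.m≤n⇒m<n∨m≡n (subst (toℕ z ℕ.≤_) toℕ-⊤ (≤⊤ z))
  ... | inj₂ z≡⊤ = inj₂ (Fin.toℕ-injective (trans z≡⊤ (sym toℕ-⊤)))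
  ... | inj₁ (ℕ.s≤s z≤k) = inj₁ (Fin.toℕ-injective (trans
          (ℕ.≤-antisym z≤k (subst (ℕ._≤ toℕ z) toℕ-a₁ a₁≤z)) (sym toℕ-a₁)))

  UpperK : K → Set
  UpperK (a , b) = Upper a ⊎ Upper b

  upperK⇒K∅ : ∀ p → UpperK p → K∅ p
  upperK⇒K∅ (a , b) (inj₁ up) with upper⇒a₁⊎⊤ a up
  ... | inj₁ refl = b , inj₂ (inj₂ (inj₂ refl))
  ... | inj₂ refl = b , inj₂ (inj₁ refl)
  upperK⇒K∅ (a , b) (inj₂ up) with upper⇒a₁⊎⊤ b up
  ... | inj₁ refl = a , inj₂ (inj₂ (inj₁ refl))
  ... | inj₂ refl = a , inj₁ refl

  K∅⇒upperK : ∀ p → K∅ p → UpperK p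
  K∅⇒upperK _ (_ , inj₁ refl)                 = inj₂ upper-⊤
  K∅⇒upperK _ (_ , inj₂ (inj₁ refl))          = inj₁ upper-⊤
  K∅⇒upperK _ (_ , inj₂ (inj₂ (inj₁ refl)))   = inj₂ upper-a₁
  K∅⇒upperK _ (_ , inj₂ (inj₂ (inj₂ refl)))   = inj₁ upper-a₁

  ⊓-sel : ∀ x y → x ⊓ y ≡ x ⊎ x ⊓ y ≡ y
  ⊓-sel x y with x ≤? y
  ... | yes _ = inj₁ refl
  ... | no  _ = inj₂ refl

  x≤y⇒x⊓y≡x : ∀ {x y} → x Fin.≤ y → x ⊓ y ≡ x
  x≤y⇒x⊓y≡x {x} {y} x≤y with x ≤? y
  ... | yes _   = refl
  ... | no  x≰y = contradiction x≤y x≰y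

  y≤x⇒x⊓y≡y : ∀ {x y} → y Fin.≤ x → x ⊓ y ≡ y
  y≤x⇒x⊓y≡y {x} {y} y≤x with x ≤? y
  ... | yes x≤y = Fin.≤-antisym x≤y y≤x
  ... | no  _   = refl

  ⊓-identityˡ : ∀ y → ⊤D ⊓ y ≡ y
  ⊓-identityˡ y = y≤x⇒x⊓y≡y (≤⊤ y)

  ⊓-identityʳ : ∀ x → x ⊓ ⊤D ≡ x
  ⊓-identityʳ x = x≤y⇒x⊓y≡x (≤⊤ x)

  ⊔-zeroʳ : ∀ x → x ⊔ ⊤D ≡ ⊤D
  ⊔-zeroʳ x with x ≤? ⊤D
  ... | yes _   = refl
  ... | no  x≰⊤ = contradiction (≤⊤ x) x≰⊤

  ⊓-upper : ∀ {x y} → Upper x → Upper y → Upper (x ⊓ y)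
  ⊓-upper {x} {y} ux uy with ⊓-sel x y
  ... | inj₁ eq = subst Upper (sym eq) ux
  ... | inj₂ eq = subst Upper (sym eq) uy

  ⊓-upperˡ : ∀ {u} x → Upper u → u ⊓ x ≡ x ⊎ Upper (u ⊓ x)
  ⊓-upperˡ {u} x uu with ⊓-sel u x
  ... | inj₁ eq = inj₂ (subst Upper (sym eq) uu)
  ... | inj₂ eq = inj₁ eq

  ⊓-upperʳ : ∀ {u} x → Upper u → x ⊓ u ≡ x ⊎ Upper (x ⊓ u)
  ⊓-upperʳ {u} x uu with ⊓-sel x u
  ... | inj₁ eq = inj₁ eq
  ... | inj₂ eq = inj₂ (subst Upper (sym eq) uu)

  ⊔-upperˡ : ∀ {x} y → Upper x → Upper (x ⊔ y)
  ⊔-upperˡ {x} y ux with x ≤? y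
  ... | yes x≤y = Fin.≤-trans ux x≤y
  ... | no  _   = ux

  ⊔-upperʳ : ∀ x {y} → Upper y → Upper (x ⊔ y)
  ⊔-upperʳ x {y} uy with x ≤? y
  ... | yes _   = uy
  ... | no  x≰y = Fin.≤-trans uy (ℕ.<⇒≤ (ℕ.≰⇒> x≰y))

  x≤y⇒x⇒y≡⊤ : ∀ {x y} → x Fin.≤ y → x ⇒ y ≡ ⊤D
  x≤y⇒x⇒y≡⊤ {x} {y} x≤y with x ≤? y
  ... | yes _   = refl
  ... | no  x≰y = contradiction x≤y x≰y

  x≰y⇒x⇒y≡a₁ : ∀ {x y} → ¬ x Fin.≤ y → x ≢ ⊤D → x ⇒ y ≡ a₁
  x≰y⇒x⇒y≡a₁ {x} {y} x≰y x≢⊤ with x ≤? y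
  ... | yes x≤y = contradiction x≤y x≰y
  ... | no  _ with x ≟ ⊤D
  ...   | yes x≡⊤ = contradiction x≡⊤ x≢⊤
  ...   | no  _   = refl

  ⇒-identityˡ : ∀ y → ⊤D ⇒ y ≡ y
  ⇒-identityˡ y with ⊤D ≤? y
  ... | yes ⊤≤y = Fin.≤-antisym ⊤≤y (≤⊤ y)
  ... | no  _ with ⊤D ≟ ⊤D
  ...   | yes _   = refl
  ...   | no  ⊤≢⊤ = contradiction refl ⊤≢⊤

  ⇒-upper : ∀ {x} y → x ≢ ⊤D → Upper (x ⇒ y)
  ⇒-upper {x} y x≢⊤ with x ≤? y
  ... | yes _ = upper-⊤
  ... | no  _ with x ≟ ⊤D
  ...   | yes x≡⊤ = contradiction x≡⊤ x≢⊤
  ...   | no  _   = upper-a₁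

  ·-identityˡ : ∀ y → ⊤D · y ≡ y
  ·-identityˡ y with ⊤D ≟ ⊤D
  ... | yes _   = ⊓-identityˡ y
  ... | no  ⊤≢⊤ = contradiction refl ⊤≢⊤

  ·-identityʳ : ∀ x → x · ⊤D ≡ x
  ·-identityʳ x with x ≟ ⊤D | ⊤D ≟ ⊤D
  ... | yes _ | _       = ⊓-identityʳ x
  ... | no  _ | yes _   = ⊓-identityʳ x
  ... | no  _ | no  ⊤≢⊤ = contradiction refl ⊤≢⊤

  ·-nonunit : ∀ {x y} → x ≢ ⊤D → y ≢ ⊤D → x · y ≡ ⊥D
  ·-nonunit {x} {y} x≢⊤ y≢⊤ with x ≟ ⊤D | y ≟ ⊤D
  ... | yes x≡⊤ | _       = contradiction x≡⊤ x≢⊤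
  ... | no  _   | yes y≡⊤ = contradiction y≡⊤ y≢⊤
  ... | no  _   | no  _   = refl

  ∼-swap : ∀ a b → ∼ (a , b) ≡ (b , a)
  ∼-swap a b = cong₂ _,_
    (trans (cong₂ _⊓_ (x≤y⇒x⇒y≡⊤ (≤⊤ a)) (⇒-identityˡ b)) (⊓-identityˡ b))
    (·-identityʳ a)

  ·K-cases : ∀ x y → UpperK (x ·K y) ⊎ x ·K y ≡ x ⊎ x ·K y ≡ y
  ·K-cases (a , b) (c , d) = by-cases (a ≟ ⊤D) (c ≟ ⊤D)
    where
    by-cases : Dec (a ≡ ⊤D) → Dec (c ≡ ⊤D) → UpperK ((a , b) ·K (c , d))
      ⊎ (a , b) ·K (c , d) ≡ (a , b) ⊎ (a , b) ·K (c , d) ≡ (c , d)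
    by-cases (yes refl) (yes refl) rewrite ·-identityˡ ⊤D = inj₁ (inj₁ upper-⊤)
    by-cases (yes refl) (no c≢⊤) rewrite ·-identityˡ c | ⇒-identityˡ d
      with ⊓-upperʳ d (⇒-upper b c≢⊤)
    ... | inj₁ eq = inj₂ (inj₂ (cong (c ,_) eq))
    ... | inj₂ up = inj₁ (inj₂ up)
    by-cases (no a≢⊤) (yes refl) rewrite ·-identityʳ a | ⇒-identityˡ b
      with ⊓-upperˡ b (⇒-upper d a≢⊤)
    ... | inj₁ eq = inj₂ (inj₁ (cong (a ,_) eq))
    ... | inj₂ up = inj₁ (inj₂ up)
    by-cases (no a≢⊤) (no c≢⊤) =
      inj₁ (inj₂ (⊓-upper (⇒-upper d a≢⊤) (⇒-upper b c≢⊤)))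

  ⇒K-cases : ∀ x y → UpperK (x ⇒K y) ⊎ x ⇒K y ≡ y ⊎ x ⇒K y ≡ ∼ x
  ⇒K-cases (a , b) (c , d) rewrite ∼-swap a b = by-cases (a ≟ ⊤D) (d ≟ ⊤D)
    where
    by-cases : Dec (a ≡ ⊤D) → Dec (d ≡ ⊤D) → UpperK ((a , b) ⇒K (c , d))
      ⊎ (a , b) ⇒K (c , d) ≡ (c , d) ⊎ (a , b) ⇒K (c , d) ≡ (b , a)
    by-cases (yes refl) (yes refl) rewrite ·-identityˡ ⊤D = inj₁ (inj₂ upper-⊤)
    by-cases (yes refl) (no d≢⊤) rewrite ·-identityˡ d | ⇒-identityˡ c
      with ⊓-upperʳ c (⇒-upper b d≢⊤)
    ... | inj₁ eq = inj₂ (inj₁ (cong (_, d) eq))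
    ... | inj₂ up = inj₁ (inj₁ up)
    by-cases (no a≢⊤) (yes refl) rewrite ·-identityʳ a | ⇒-identityˡ b
      with ⊓-upperˡ b (⇒-upper c a≢⊤)
    ... | inj₁ eq = inj₂ (inj₂ (cong (_, a) eq))
    ... | inj₂ up = inj₁ (inj₁ up)
    by-cases (no a≢⊤) (no d≢⊤) =
      inj₁ (inj₁ (⊓-upper (⇒-upper c a≢⊤) (⇒-upper b d≢⊤)))

  ⊤-column⇒admissible : ∀ S → (∀ x → S (x , ⊤D)) → IsAdmissible S
  ⊤-column⇒admissible S ⊤-column (a , b) = mk⇔ below⇒⊤-column ⊤-column⇒below
    where
    below⇒⊤-column : S (a , b) × (a , b) ≤K 1K → ∃[ x ] (a , b) ≡ (x , ⊤D)
    below⇒⊤-column (_ , ≤1K) =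
      a , cong (a ,_) (trans (sym (cong proj₂ ≤1K)) (⊔-zeroʳ b))
    ⊤-column⇒below : ∃[ x ] (a , b) ≡ (x , ⊤D) → S (a , b) × (a , b) ≤K 1K
    ⊤-column⇒below (x , refl) = ⊤-column x , cong₂ _,_ (⊓-identityʳ x) (⊔-zeroʳ ⊤D)

  ∼-closed-sublattice⇒admissibleSubalgebra : ∀ L → IsSublattice L →
    (∀ x → L x → L (∼ x)) → K∅ ⊆ L → IsAdmissibleSubalgebra L
  ∼-closed-sublattice⇒admissibleSubalgebra L sl ∼-closed K∅⊆L =
    record
      { ∨-closed = IsSublattice.∨-closed sl
      ; ∧-closed = IsSublattice.∧-closed sl
      ; ·-closed = ·-closed
      ; ⇒-closed = ⇒-closed
      ; 1-closed = K∅⊆L _ (⊤D , inj₁ refl)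
      ; 0-closed = K∅⊆L _ (⊥D , inj₁ refl)
      }
    , ⊤-column⇒admissible L (λ x → K∅⊆L _ (x , inj₁ refl))
    where
    ·-closed : ∀ x y → L x → L y → L (x ·K y)
    ·-closed x y Lx Ly with ·K-cases x y
    ... | inj₁ up        = K∅⊆L _ (upperK⇒K∅ _ up)
    ... | inj₂ (inj₁ eq) = subst L (sym eq) Lx
    ... | inj₂ (inj₂ eq) = subst L (sym eq) Ly
    ⇒-closed : ∀ x y → L x → L y → L (x ⇒K y)
    ⇒-closed x y Lx Ly with ⇒K-cases x y
    ... | inj₁ up        = K∅⊆L _ (upperK⇒K∅ _ up)
    ... | inj₂ (inj₁ eq) = subst L (sym eq) Ly
    ... | inj₂ (inj₂ eq) = subst L (sym eq) (∼-closed x Lx)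

  K∅-sublattice : IsSublattice K∅
  K∅-sublattice = record { ∨-closed = ∨-closed ; ∧-closed = ∧-closed }
    where
    ∨-closed : ∀ x y → K∅ x → K∅ y → K∅ (x ∨K y)
    ∨-closed (a , b) (c , d) p q with K∅⇒upperK _ p | K∅⇒upperK _ q
    ... | inj₁ ua | _      = upperK⇒K∅ _ (inj₁ (⊔-upperˡ c ua))
    ... | inj₂ _  | inj₁ uc = upperK⇒K∅ _ (inj₁ (⊔-upperʳ a uc))
    ... | inj₂ ub | inj₂ ud = upperK⇒K∅ _ (inj₂ (⊓-upper ub ud))
    ∧-closed : ∀ x y → K∅ x → K∅ y → K∅ (x ∧K y)
    ∧-closed (a , b) (c , d) p q with K∅⇒upperK _ p | K∅⇒upperK _ q
    ... | inj₂ ub | _      = upperK⇒K∅ _ (inj₂ (⊔-upperˡ d ub))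
    ... | inj₁ _  | inj₂ ud = upperK⇒K∅ _ (inj₂ (⊔-upperʳ b ud))
    ... | inj₁ ua | inj₁ uc = upperK⇒K∅ _ (inj₁ (⊓-upper ua uc))

  K∅-∼-closed : ∀ x → K∅ x → K∅ (∼ x)
  K∅-∼-closed (a , b) p rewrite ∼-swap a b with K∅⇒upperK _ p
  ... | inj₁ ua = upperK⇒K∅ _ (inj₂ ua)
  ... | inj₂ ub = upperK⇒K∅ _ (inj₁ ub)

  K∅-admissibleSubalgebra : IsAdmissibleSubalgebra K∅
  K∅-admissibleSubalgebra = ∼-closed-sublattice⇒admissibleSubalgebra
    K∅ K∅-sublattice K∅-∼-closed (λ _ p → p)

  ·K-⊤⊥ : ∀ {x} → ⊥D Fin.< x → x ≢ ⊤D → (x , ⊤D) ·K (⊤D , ⊥D) ≡ (x , a₁)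
  ·K-⊤⊥ {x} ⊥<x x≢⊤ = cong₂ _,_ (·-identityʳ x) (begin
    (x ⇒ ⊥D) ⊓ (⊤D ⇒ ⊤D) ≡⟨ cong₂ _⊓_ (x≰y⇒x⇒y≡a₁ (ℕ.<⇒≱ ⊥<x) x≢⊤) (x≤y⇒x⇒y≡⊤ (≤⊤ ⊤D)) ⟩
    a₁ ⊓ ⊤D              ≡⟨ ⊓-identityʳ a₁ ⟩
    a₁                   ∎)
    where open ≡-Reasoning

  ·K-a₁ : ∀ {y} → y Fin.< a₁ → (a₁ , ⊤D) ·K (a₁ , y) ≡ (⊥D , a₁)
  ·K-a₁ {y} y<a₁ = cong₂ _,_ (·-nonunit a₁≢⊤ a₁≢⊤) (begin
    (a₁ ⇒ y) ⊓ (a₁ ⇒ ⊤D) ≡⟨ cong₂ _⊓_ (x≰y⇒x⇒y≡a₁ (ℕ.<⇒≱ y<a₁) a₁≢⊤) (x≤y⇒x⇒y≡⊤ (≤⊤ a₁)) ⟩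
    a₁ ⊓ ⊤D              ≡⟨ ⊓-identityʳ a₁ ⟩
    a₁                   ∎)
    where open ≡-Reasoning

  K∅-least : 2 ≤ k → ∀ S → IsAdmissibleSubalgebra S → K∅ ⊆ S
  K∅-least 2≤k S (subalgebra , admissible) = λ where
      _ (x , inj₁ refl)                → ⊤-column x
      _ (x , inj₂ (inj₁ refl))         → ∼-closed (⊤-column x)
      _ (x , inj₂ (inj₂ (inj₁ refl)))  → a₁-column x
      _ (x , inj₂ (inj₂ (inj₂ refl)))  → ∼-closed (a₁-column x)
    where
    open IsSubalgebra subalgebra
    ⊤-column : ∀ x → S (x , ⊤D)
    ⊤-column x = proj₁ (Equivalence.from (admissible (x , ⊤D)) (x , refl))
    ∼-closed : ∀ {a b} → S (a , b) → S (b , a)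
    ∼-closed {a} {b} s = subst S (∼-swap a b) (⇒-closed _ _ s 1-closed)
    a₁-column-suc : ∀ x → suc x ≢ ⊤D → S (suc x , a₁)
    a₁-column-suc x x≢⊤ = subst S (·K-⊤⊥ (ℕ.s≤s ℕ.z≤n) x≢⊤)
      (·-closed _ _ (⊤-column (suc x)) (∼-closed (⊤-column ⊥D)))
    1<a₁ : suc {suc k} zero Fin.< a₁
    1<a₁ = subst (1 ℕ.<_) (sym toℕ-a₁) 2≤k
    a₁-column : ∀ x → S (x , a₁)
    a₁-column zero = subst S (·K-a₁ 1<a₁)
      (·-closed _ _ (⊤-column a₁) (∼-closed (a₁-column-suc zero (<a₁⇒≢⊤ 1<a₁))))
    a₁-column (suc x) with suc x ≟ ⊤D
    ... | yes refl = ∼-closed (⊤-column a₁)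
    ... | no  x≢⊤  = a₁-column-suc x x≢⊤

open DP-Properties

lemma3p5 : (k : ℕ) → 2 ≤ k →
    let open DP k in
    (IsAdmissibleSubalgebra K∅
      × (∀ S → IsAdmissibleSubalgebra S → K∅ ⊆ S))
    × (∀ L → IsSublattice L → (∀ x → L x → L (∼ x)) → K∅ ⊆ L →
         IsAdmissibleSubalgebra L)
lemma3p5 k 2≤k =
  (K∅-admissibleSubalgebra k , K∅-least k 2≤k) ,
  ∼-closed-sublattice⇒admissibleSubalgebra k
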